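{- For a connected graph $G$ and every integer $k \ge 1$, \[c_d(G^{\square k}) = \frac{c_d(G)}{k}.\]
   Context: The Cartesian product $A \square B$ has vertex set $V(A)\times V(B)$, with $(a,b)$ adjacent to $(a',b')$ iff either $aa' \in E(A)$ and $b=b'$, or $bb' \in E(B)$ and $a = a'$. $G^{\square k}$ is the $k$-fold Cartesian power $G\square\cdots\square G$. For $v\in\mathbb{R}^N_+$ with mean $\mu$ and (population) standard deviation $\sigma$, $\sigma^2=\frac1N\sum_i(v_i-\mu)^2$, set $c_v=(\sigma/\mu)^2$; $c_d(G)=c_d$ where $d$ is the degree vector of $G$. -}

module Defs where

open import Data.Bool using (Bool; true; false; _∧_; _∨_)
open import Data.Nat as ℕ using (ℕ; zero; suc; _≤_)
open import Data.Fin as Fin using (Fin; remQuot)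
open import Data.Fin.Properties using (_≟_)
open import Data.Integer using (+_)
open import Data.Rational as ℚ using (ℚ; 0ℚ; _+_; _-_; _*_; _/_; 1/_; ≢-nonZero)
open import Data.Product using (_×_; _,_)
open import Data.Maybe using (Maybe; just; nothing)
open import Relation.Nullary using (yes; no)
open import Relation.Nullary.Decidable using (⌊_⌋)
open import Relation.Binary.PropositionalEquality using (_≡_; _≢_)

record Graph : Set where
  constructor mkGraph
  field
    n   : ℕ
    adj : Fin n → Fin n → Bool
open Graph public

record IsSimple (G : Graph) : Set where
  field
    symmetric  : ∀ u v → adj G u v ≡ adj G v u
    irreflexive : ∀ u → adj G u u ≡ false

data Reach (G : Graph) : Fin (n G) → Fin (n G) → Set where
  here : ∀ {u} → Reach G u u
  step : ∀ {u w v} → adj G u w ≡ true → Reach G w v → Reach G u v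

record Connected (G : Graph) : Set where
  field
    nonempty  : 1 ≤ n G
    reachable : ∀ u v → Reach G u v

-- Cartesian product; vertex (a,b) is encoded as Fin.combine a b : Fin (n A * n B)
_□_ : Graph → Graph → Graph
A □ B = mkGraph (n A ℕ.* n B) adjP
  where
  adjP : Fin (n A ℕ.* n B) → Fin (n A ℕ.* n B) → Bool
  adjP x y with remQuot {n A} (n B) x | remQuot {n A} (n B) y
  ... | (a , b) | (a' , b') =
    (adj A a a' ∧ ⌊ b ≟ b' ⌋) ∨ (adj B b b' ∧ ⌊ a ≟ a' ⌋)

K₁ : Graph
K₁ = mkGraph 1 (λ _ _ → false)

_^□_ : Graph → ℕ → Graph
G ^□ zero  = K₁
G ^□ suc k = G □ (G ^□ k)

Σ : (N : ℕ) → (Fin N → ℚ) → ℚ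
Σ zero    f = 0ℚ
Σ (suc N) f = f Fin.zero + Σ N (λ i → f (Fin.suc i))

boolℕ : Bool → ℕ
boolℕ true  = 1
boolℕ false = 0

sumℕ : (N : ℕ) → (Fin N → ℕ) → ℕ
sumℕ zero    f = 0
sumℕ (suc N) f = f Fin.zero ℕ.+ sumℕ N (λ i → f (Fin.suc i))

degree : (G : Graph) → Fin (n G) → ℕ
degree G u = sumℕ (n G) (λ v → boolℕ (adj G u v))

toℚ : ℕ → ℚ
toℚ m = (+ m) / 1

-- c_v = (σ/μ)² = σ²/μ², with μ the mean and σ² the population variance.
-- Undefined (nothing) when N = 0 or μ = 0.
mean : (N : ℕ) → .{{ℕ.NonZero N}} → (Fin N → ℚ) → ℚ
mean N v = Σ N v * ((+ 1) / N)

variance : (N : ℕ) → .{{ℕ.NonZero N}} → (Fin N → ℚ) → ℚ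
variance N v = mean N (λ i → (v i - mean N v) * (v i - mean N v))

cv : (N : ℕ) → (Fin N → ℚ) → Maybe ℚ
cv zero    v = nothing
cv (suc N) v with mean (suc N) v ℚ.≟ 0ℚ
... | yes _  = nothing
... | no μ≢0 = just (variance (suc N) v * (1/μ * 1/μ))
  where
  instance
    nz : ℚ.NonZero (mean (suc N) v)
    nz = ≢-nonZero μ≢0
  1/μ = 1/ (mean (suc N) v)

cd : Graph → Maybe ℚ
cd G = cv (n G) (λ u → toℚ (degree G u))

{-# OPTIONS --safe #-}
-- In A □ B the degree of (a, b) is deg a + deg b. Summing over the product, the degree sum
-- S and the dispersion D = N Σ d² − S² (N² times the variance) satisfy
-- S(A □ B) = |B| S(A) + |A| S(B) and D(A □ B) = |B|² D(A) + |A|² D(B): the cross terms cancel.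
-- With n = |G| and N_k = |G^□k|, induction on k gives n S_k = k N_k S and n² D_k = k N_k² D,
-- so c_d = D / S² is divided by exactly k.
module Submission where

open import Algebra.Bundles using (Semiring; CommutativeRing)
import Algebra.Properties.CommutativeSemigroup as CommutativeSemigroupProperties
open import Data.Fin as Fin using (Fin; _↑ˡ_; _↑ʳ_; combine)
open import Data.Nat as ℕ using (ℕ; zero; suc; NonZero)
open import Function using (_∘_)

module FiniteSum {c ℓ} (R : Semiring c ℓ) where

  open Semiring R
  open import Relation.Binary.Reasoning.Setoid setoid
  open CommutativeSemigroupProperties +-commutativeSemigroup using (interchange)

  module Properties
    (∑ : ∀ N → (Fin N → Carrier) → Carrier)
    (∑-zero : ∀ {f} → ∑ 0 f ≈ 0#)
    (∑-suc : ∀ {N f} → ∑ (suc N) f ≈ f Fin.zero + ∑ N (f ∘ Fin.suc))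
    where

    ∑-cong : ∀ N {f g : Fin N → Carrier} → (∀ i → f i ≈ g i) → ∑ N f ≈ ∑ N g
    ∑-cong zero    {f} {g} f≈g = trans ∑-zero (sym ∑-zero)
    ∑-cong (suc N) {f} {g} f≈g = begin
      ∑ (suc N) f                        ≈⟨ ∑-suc ⟩
      f Fin.zero + ∑ N (f ∘ Fin.suc)     ≈⟨ +-cong (f≈g Fin.zero) (∑-cong N (f≈g ∘ Fin.suc)) ⟩
      g Fin.zero + ∑ N (g ∘ Fin.suc)     ≈⟨ ∑-suc ⟨
      ∑ (suc N) g                        ∎

    ∑-0# : ∀ N → ∑ N (λ _ → 0#) ≈ 0#
    ∑-0# zero    = ∑-zero
    ∑-0# (suc N) = trans ∑-suc (trans (+-identityˡ _) (∑-0# N))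

    ∑-distrib-+ : ∀ N (f g : Fin N → Carrier) → ∑ N (λ i → f i + g i) ≈ ∑ N f + ∑ N g
    ∑-distrib-+ zero    f g = trans ∑-zero (sym (trans (+-cong ∑-zero ∑-zero) (+-identityˡ 0#)))
    ∑-distrib-+ (suc N) f g = begin
      ∑ (suc N) (λ i → f i + g i)
        ≈⟨ ∑-suc ⟩
      (f Fin.zero + g Fin.zero) + ∑ N (λ i → f (Fin.suc i) + g (Fin.suc i))
        ≈⟨ +-congˡ (∑-distrib-+ N (f ∘ Fin.suc) (g ∘ Fin.suc)) ⟩
      (f Fin.zero + g Fin.zero) + (∑ N (f ∘ Fin.suc) + ∑ N (g ∘ Fin.suc))
        ≈⟨ interchange _ _ _ _ ⟩
      (f Fin.zero + ∑ N (f ∘ Fin.suc)) + (g Fin.zero + ∑ N (g ∘ Fin.suc))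
        ≈⟨ +-cong ∑-suc ∑-suc ⟨
      ∑ (suc N) f + ∑ (suc N) g
        ∎

    *-distribˡ-∑ : ∀ N x (f : Fin N → Carrier) → x * ∑ N f ≈ ∑ N (λ i → x * f i)
    *-distribˡ-∑ zero    x f = trans (*-congˡ ∑-zero) (trans (zeroʳ x) (sym ∑-zero))
    *-distribˡ-∑ (suc N) x f = begin
      x * ∑ (suc N) f                              ≈⟨ *-congˡ ∑-suc ⟩
      x * (f Fin.zero + ∑ N (f ∘ Fin.suc))         ≈⟨ distribˡ x _ _ ⟩
      x * f Fin.zero + x * ∑ N (f ∘ Fin.suc)       ≈⟨ +-congˡ (*-distribˡ-∑ N x (f ∘ Fin.suc)) ⟩
      x * f Fin.zero + ∑ N (λ i → x * f (Fin.suc i)) ≈⟨ ∑-suc ⟨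
      ∑ (suc N) (λ i → x * f i)                    ∎

    *-distribʳ-∑ : ∀ N x (f : Fin N → Carrier) → ∑ N f * x ≈ ∑ N (λ i → f i * x)
    *-distribʳ-∑ zero    x f = trans (*-congʳ ∑-zero) (trans (zeroˡ x) (sym ∑-zero))
    *-distribʳ-∑ (suc N) x f = begin
      ∑ (suc N) f * x                              ≈⟨ *-congʳ ∑-suc ⟩
      (f Fin.zero + ∑ N (f ∘ Fin.suc)) * x         ≈⟨ distribʳ x _ _ ⟩
      f Fin.zero * x + ∑ N (f ∘ Fin.suc) * x       ≈⟨ +-congˡ (*-distribʳ-∑ N x (f ∘ Fin.suc)) ⟩
      f Fin.zero * x + ∑ N (λ i → f (Fin.suc i) * x) ≈⟨ ∑-suc ⟨
      ∑ (suc N) (λ i → f i * x)                    ∎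

    ∑-↑ : ∀ m n (F : Fin (m ℕ.+ n) → Carrier) →
          ∑ (m ℕ.+ n) F ≈ ∑ m (F ∘ (_↑ˡ n)) + ∑ n (F ∘ (m ↑ʳ_))
    ∑-↑ zero    n F = sym (trans (+-congʳ ∑-zero) (+-identityˡ _))
    ∑-↑ (suc m) n F = begin
      ∑ (suc m ℕ.+ n) F
        ≈⟨ ∑-suc ⟩
      F Fin.zero + ∑ (m ℕ.+ n) (F ∘ Fin.suc)
        ≈⟨ +-congˡ (∑-↑ m n (F ∘ Fin.suc)) ⟩
      F Fin.zero + (∑ m (F ∘ Fin.suc ∘ (_↑ˡ n)) + ∑ n (F ∘ (suc m ↑ʳ_)))
        ≈⟨ +-assoc _ _ _ ⟨
      (F Fin.zero + ∑ m (F ∘ Fin.suc ∘ (_↑ˡ n))) + ∑ n (F ∘ (suc m ↑ʳ_))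
        ≈⟨ +-congʳ ∑-suc ⟨
      ∑ (suc m) (F ∘ (_↑ˡ n)) + ∑ n (F ∘ (suc m ↑ʳ_))
        ∎

    ∑-combine : ∀ m n (F : Fin (m ℕ.* n) → Carrier) →
                ∑ (m ℕ.* n) F ≈ ∑ m (λ a → ∑ n (λ b → F (combine a b)))
    ∑-combine zero    n F = trans ∑-zero (sym ∑-zero)
    ∑-combine (suc m) n F = begin
      ∑ (n ℕ.+ m ℕ.* n) F
        ≈⟨ ∑-↑ n (m ℕ.* n) F ⟩
      ∑ n (λ b → F (combine (Fin.zero {m}) b)) + ∑ (m ℕ.* n) (F ∘ (n ↑ʳ_))
        ≈⟨ +-congˡ (∑-combine m n (F ∘ (n ↑ʳ_))) ⟩
      ∑ n (λ b → F (combine (Fin.zero {m}) b)) + ∑ m (λ a → ∑ n (λ b → F (combine (Fin.suc a) b)))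
        ≈⟨ ∑-suc ⟨
      ∑ (suc m) (λ a → ∑ n (λ b → F (combine a b)))
        ∎

    ∑∑-distrib-+ : ∀ m n (F G : Fin m → Fin n → Carrier) →
                   ∑ m (λ a → ∑ n (λ b → F a b + G a b))
                     ≈ ∑ m (λ a → ∑ n (F a)) + ∑ m (λ a → ∑ n (G a))
    ∑∑-distrib-+ m n F G =
      trans (∑-cong m (λ a → ∑-distrib-+ n (F a) (G a))) (∑-distrib-+ m _ _)

-- Imported only here: the unqualified ℚ operators would clash with the semiring operators
-- opened inside FiniteSum.
open import Defs
open import Data.Bool using (Bool; true; false; _∧_; _∨_)
open import Data.Bool.Properties using (∧-zeroʳ)
open import Data.Empty using (⊥; ⊥-elim)
open import Data.Fin.Properties using (_≟_; remQuot-combine)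
open import Data.Integer as ℤ using (+_)
import Data.Integer.Properties as ℤP
open import Data.Maybe using (Maybe; just; nothing; map)
import Data.Nat.Coprimality as Coprimality
import Data.Nat.Properties as ℕP
open import Data.Product using (_×_; _,_)
open import Data.Rational as ℚ using (ℚ; mkℚ; 0ℚ; 1ℚ; _+_; _*_; _-_; -_; _/_; 1/_)
import Data.Rational.Properties as ℚP
open import Level using (0ℓ)
open import Relation.Binary.PropositionalEquality
  using (_≡_; _≢_; refl; sym; trans; cong; cong₂; module ≡-Reasoning)
open import Relation.Nullary using (yes; no)
open import Relation.Nullary.Decidable using (⌊_⌋; ⌊⌋-map′; dec⇒maybe)
open import Tactic.RingSolver using (solve-∀)
open import Tactic.RingSolver.Core.AlmostCommutativeRing
  using (AlmostCommutativeRing; fromCommutativeRing)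

module Σℕ = FiniteSum.Properties ℕP.+-*-semiring sumℕ refl refl
module Σℚ = FiniteSum.Properties (CommutativeRing.semiring ℚP.+-*-commutativeRing) Σ refl refl

δ : ∀ {N} → Fin N → Fin N → ℕ
δ i j = boolℕ ⌊ i ≟ j ⌋

sumℕ-δ : ∀ {N} (i : Fin N) → sumℕ N (δ i) ≡ 1
sumℕ-δ {suc N} Fin.zero    = cong suc (Σℕ.∑-0# N)
sumℕ-δ {suc N} (Fin.suc i) =
  trans (Σℕ.∑-cong N (λ j → cong boolℕ (⌊⌋-map′ _ _ (i ≟ j)))) (sumℕ-δ i)

boolℕ-∧ : ∀ x y → boolℕ (x ∧ y) ≡ boolℕ x ℕ.* boolℕ y
boolℕ-∧ true  y = sym (ℕP.+-identityʳ (boolℕ y))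
boolℕ-∧ false y = refl

boolℕ-∨ : ∀ x y → (x ≡ true → y ≡ true → ⊥) → boolℕ (x ∨ y) ≡ boolℕ x ℕ.+ boolℕ y
boolℕ-∨ true  true  exclusive = ⊥-elim (exclusive refl refl)
boolℕ-∨ true  false _         = refl
boolℕ-∨ false y     _         = refl

adj-□-combine : ∀ A B a b a′ b′ → adj (A □ B) (combine a b) (combine a′ b′)
                  ≡ (adj A a a′ ∧ ⌊ b ≟ b′ ⌋) ∨ (adj B b b′ ∧ ⌊ a ≟ a′ ⌋)
adj-□-combine A B a b a′ b′ =
  cong₂ adjacent (remQuot-combine {n A} {n B} a b) (remQuot-combine {n A} {n B} a′ b′)
  where
  adjacent : Fin (n A) × Fin (n B) → Fin (n A) × Fin (n B) → Bool
  adjacent (a , b) (a′ , b′) = (adj A a a′ ∧ ⌊ b ≟ b′ ⌋) ∨ (adj B b b′ ∧ ⌊ a ≟ a′ ⌋)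

module _ (A B : Graph) (loopless : ∀ u → adj A u u ≡ false) where

  boolℕ-adj-□ : ∀ a b a′ b′ → boolℕ (adj (A □ B) (combine a b) (combine a′ b′))
                  ≡ boolℕ (adj A a a′) ℕ.* δ b b′ ℕ.+ boolℕ (adj B b b′) ℕ.* δ a a′
  boolℕ-adj-□ a b a′ b′ = begin
    boolℕ (adj (A □ B) (combine a b) (combine a′ b′))
      ≡⟨ cong boolℕ (adj-□-combine A B a b a′ b′) ⟩
    boolℕ ((adj A a a′ ∧ ⌊ b ≟ b′ ⌋) ∨ (adj B b b′ ∧ ⌊ a ≟ a′ ⌋))
      ≡⟨ boolℕ-∨ _ _ exclusive ⟩
    boolℕ (adj A a a′ ∧ ⌊ b ≟ b′ ⌋) ℕ.+ boolℕ (adj B b b′ ∧ ⌊ a ≟ a′ ⌋)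
      ≡⟨ cong₂ ℕ._+_ (boolℕ-∧ (adj A a a′) _) (boolℕ-∧ (adj B b b′) _) ⟩
    boolℕ (adj A a a′) ℕ.* δ b b′ ℕ.+ boolℕ (adj B b b′) ℕ.* δ a a′
      ∎
    where
    open ≡-Reasoning
    exclusive : adj A a a′ ∧ ⌊ b ≟ b′ ⌋ ≡ true → adj B b b′ ∧ ⌊ a ≟ a′ ⌋ ≡ true → ⊥
    exclusive moveA moveB with a ≟ a′
    ... | yes refl with trans (sym (cong (_∧ ⌊ b ≟ b′ ⌋) (loopless a))) moveA
    ...   | ()
    exclusive moveA moveB | no _ with trans (sym (∧-zeroʳ (adj B b b′))) moveB
    ...   | ()

  degree-□ : ∀ a b → degree (A □ B) (combine a b) ≡ degree A a ℕ.+ degree B b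
  degree-□ a b = begin
    degree (A □ B) (combine a b)
      ≡⟨ Σℕ.∑-combine (n A) (n B) _ ⟩
    sumℕ (n A) (λ a′ → sumℕ (n B) (λ b′ → boolℕ (adj (A □ B) (combine a b) (combine a′ b′))))
      ≡⟨ Σℕ.∑-cong (n A) (λ a′ → Σℕ.∑-cong (n B) (boolℕ-adj-□ a b a′)) ⟩
    sumℕ (n A) (λ a′ → sumℕ (n B) (λ b′ → Aₐ a′ ℕ.* δ b b′ ℕ.+ Bᵦ b′ ℕ.* δ a a′))
      ≡⟨ Σℕ.∑∑-distrib-+ (n A) (n B) _ _ ⟩
    sumℕ (n A) (λ a′ → sumℕ (n B) (λ b′ → Aₐ a′ ℕ.* δ b b′))
      ℕ.+ sumℕ (n A) (λ a′ → sumℕ (n B) (λ b′ → Bᵦ b′ ℕ.* δ a a′))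
      ≡⟨ cong₂ ℕ._+_ (Σℕ.∑-cong (n A) (λ a′ → sym (Σℕ.*-distribˡ-∑ (n B) (Aₐ a′) (δ b))))
                     (Σℕ.∑-cong (n A) (λ a′ → sym (Σℕ.*-distribʳ-∑ (n B) (δ a a′) Bᵦ))) ⟩
    sumℕ (n A) (λ a′ → Aₐ a′ ℕ.* sumℕ (n B) (δ b))
      ℕ.+ sumℕ (n A) (λ a′ → degree B b ℕ.* δ a a′)
      ≡⟨ cong₂ ℕ._+_ (Σℕ.∑-cong (n A) (λ a′ → times-δ-sum (Aₐ a′) b))
                     (trans (sym (Σℕ.*-distribˡ-∑ (n A) (degree B b) (δ a))) (times-δ-sum (degree B b) a)) ⟩
    degree A a ℕ.+ degree B b
      ∎
    where
    open ≡-Reasoning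
    Aₐ : Fin (n A) → ℕ
    Aₐ a′ = boolℕ (adj A a a′)
    Bᵦ : Fin (n B) → ℕ
    Bᵦ b′ = boolℕ (adj B b b′)
    times-δ-sum : ∀ {N} x (i : Fin N) → x ℕ.* sumℕ N (δ i) ≡ x
    times-δ-sum x i = trans (cong (x ℕ.*_) (sumℕ-δ i)) (ℕP.*-identityʳ x)

ℚ-ring : AlmostCommutativeRing 0ℓ 0ℓ
ℚ-ring = fromCommutativeRing ℚP.+-*-commutativeRing (λ x → dec⇒maybe (0ℚ ℚ.≟ x))

toℚ-mkℚ : ∀ m → toℚ m ≡ mkℚ (+ m) 0 (Coprimality.sym (Coprimality.1-coprimeTo m))
toℚ-mkℚ m = ℚP.normalize-coprime (Coprimality.sym (Coprimality.1-coprimeTo m))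

toℚ-+ : ∀ m n → toℚ (m ℕ.+ n) ≡ toℚ m + toℚ n
toℚ-+ m n rewrite toℚ-mkℚ m | toℚ-mkℚ n =
  cong (_/ 1) (trans (ℤP.pos-+ m n) (sym (cong₂ ℤ._+_ (ℤP.*-identityʳ (+ m)) (ℤP.*-identityʳ (+ n)))))

toℚ-* : ∀ m n → toℚ (m ℕ.* n) ≡ toℚ m * toℚ n
toℚ-* m n rewrite toℚ-mkℚ m | toℚ-mkℚ n = cong (_/ 1) (ℤP.pos-* m n)

toℚ-≢0 : ∀ m .{{_ : NonZero m}} → toℚ m ≢ 0ℚ
toℚ-≢0 m eq = ℕ.≢-nonZero⁻¹ m (ℤP.+-injective (cong ℚ.↥_ (trans (sym (toℚ-mkℚ m)) eq)))

toℚ-*-inverse : ∀ m .{{_ : NonZero m}} → toℚ m * ((+ 1) / m) ≡ 1ℚ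
toℚ-*-inverse (suc m) rewrite toℚ-mkℚ (suc m) | ℚP.normalize-coprime (Coprimality.1-coprimeTo (suc m)) =
  ℚP.*-inverseʳ (mkℚ (+ suc m) 0 (Coprimality.sym (Coprimality.1-coprimeTo (suc m))))

*-cancelʳ-≢0 : ∀ {p q} r → r ≢ 0ℚ → p * r ≡ q * r → p ≡ q
*-cancelʳ-≢0 {p} {q} r r≢0 pr≡qr = begin
  p                ≡⟨ ℚP.*-identityʳ p ⟨
  p * 1ℚ           ≡⟨ cong (p *_) (ℚP.*-inverseʳ r) ⟨
  p * (r * 1/ r)   ≡⟨ ℚP.*-assoc p r (1/ r) ⟨
  (p * r) * 1/ r   ≡⟨ cong (_* 1/ r) pr≡qr ⟩
  (q * r) * 1/ r   ≡⟨ ℚP.*-assoc q r (1/ r) ⟩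
  q * (r * 1/ r)   ≡⟨ cong (q *_) (ℚP.*-inverseʳ r) ⟩
  q * 1ℚ           ≡⟨ ℚP.*-identityʳ q ⟩
  q                ∎
  where
  open ≡-Reasoning
  instance
    r-nonZero : ℚ.NonZero r
    r-nonZero = ℚ.≢-nonZero r≢0

p≢0∧p*q≡0⇒q≡0 : ∀ {p q} → p ≢ 0ℚ → p * q ≡ 0ℚ → q ≡ 0ℚ
p≢0∧p*q≡0⇒q≡0 {p} {q} p≢0 pq≡0 =
  *-cancelʳ-≢0 p p≢0 (trans (ℚP.*-comm q p) (trans pq≡0 (sym (ℚP.*-zeroˡ p))))

*-≢0 : ∀ {p q} → p ≢ 0ℚ → q ≢ 0ℚ → p * q ≢ 0ℚ
*-≢0 p≢0 q≢0 pq≡0 = q≢0 (p≢0∧p*q≡0⇒q≡0 p≢0 pq≡0)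

Σ-const : ∀ N x → Σ N (λ _ → x) ≡ toℚ N * x
Σ-const zero    x = sym (ℚP.*-zeroˡ x)
Σ-const (suc N) x = begin
  x + Σ N (λ _ → x)    ≡⟨ cong (λ s → x + s) (Σ-const N x) ⟩
  x + toℚ N * x        ≡⟨ identity x (toℚ N) ⟩
  (1ℚ + toℚ N) * x     ≡⟨ cong (_* x) (toℚ-+ 1 N) ⟨
  toℚ (suc N) * x      ∎
  where
  open ≡-Reasoning
  identity : ∀ x y → x + y * x ≡ (1ℚ + y) * x
  identity = solve-∀ ℚ-ring

sumOfSquares : ∀ N → (Fin N → ℚ) → ℚ
sumOfSquares N f = Σ N (λ i → f i * f i)

-- N² times the population variance of f.
dispersion : ∀ N → (Fin N → ℚ) → ℚ
dispersion N f = toℚ N * sumOfSquares N f - Σ N f * Σ N f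

module _ {m n} (f : Fin m → ℚ) (g : Fin n → ℚ) (h : Fin (m ℕ.* n) → ℚ)
         (h-split : ∀ a b → h (combine a b) ≡ f a + g b) where

  private
    Σ-combine-∘ : ∀ (φ : ℚ → ℚ) → Σ (m ℕ.* n) (φ ∘ h) ≡ Σ m (λ a → Σ n (λ b → φ (f a + g b)))
    Σ-combine-∘ φ = trans (Σℚ.∑-combine m n (φ ∘ h))
                          (Σℚ.∑-cong m (λ a → Σℚ.∑-cong n (λ b → cong φ (h-split a b))))

    ΣΣ-const-inner : ∀ (u : Fin m → ℚ) → Σ m (λ a → Σ n (λ _ → u a)) ≡ toℚ n * Σ m u
    ΣΣ-const-inner u = trans (Σℚ.∑-cong m (λ a → Σ-const n (u a)))
                             (sym (Σℚ.*-distribˡ-∑ m (toℚ n) u))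

    ΣΣ-* : ∀ (u : Fin m → ℚ) (w : Fin n → ℚ) → Σ m (λ a → Σ n (λ b → u a * w b)) ≡ Σ m u * Σ n w
    ΣΣ-* u w = trans (Σℚ.∑-cong m (λ a → sym (Σℚ.*-distribˡ-∑ n (u a) w)))
                     (sym (Σℚ.*-distribʳ-∑ m (Σ n w) u))

  Σ-combine-+ : Σ (m ℕ.* n) h ≡ toℚ n * Σ m f + toℚ m * Σ n g
  Σ-combine-+ = begin
    Σ (m ℕ.* n) h
      ≡⟨ Σ-combine-∘ (λ x → x) ⟩
    Σ m (λ a → Σ n (λ b → f a + g b))
      ≡⟨ Σℚ.∑∑-distrib-+ m n _ _ ⟩
    Σ m (λ a → Σ n (λ _ → f a)) + Σ m (λ _ → Σ n g)
      ≡⟨ cong₂ _+_ (ΣΣ-const-inner f) (Σ-const m (Σ n g)) ⟩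
    toℚ n * Σ m f + toℚ m * Σ n g
      ∎
    where open ≡-Reasoning

  sumOfSquares-combine-+ : sumOfSquares (m ℕ.* n) h
                             ≡ toℚ n * sumOfSquares m f + (Σ m f + Σ m f) * Σ n g + toℚ m * sumOfSquares n g
  sumOfSquares-combine-+ = begin
    Σ (m ℕ.* n) (λ x → h x * h x)
      ≡⟨ Σ-combine-∘ (λ x → x * x) ⟩
    Σ m (λ a → Σ n (λ b → (f a + g b) * (f a + g b)))
      ≡⟨ Σℚ.∑-cong m (λ a → Σℚ.∑-cong n (λ b → square-+ (f a) (g b))) ⟩
    Σ m (λ a → Σ n (λ b → f a * f a + (f a + f a) * g b + g b * g b))
      ≡⟨ Σℚ.∑∑-distrib-+ m n _ _ ⟩
    Σ m (λ a → Σ n (λ b → f a * f a + (f a + f a) * g b)) + Σ m (λ _ → sumOfSquares n g)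
      ≡⟨ cong₂ _+_ (Σℚ.∑∑-distrib-+ m n _ _) (Σ-const m (sumOfSquares n g)) ⟩
    Σ m (λ a → Σ n (λ _ → f a * f a)) + Σ m (λ a → Σ n (λ b → (f a + f a) * g b))
      + toℚ m * sumOfSquares n g
      ≡⟨ cong₂ (λ x y → x + y + toℚ m * sumOfSquares n g)
               (ΣΣ-const-inner (λ a → f a * f a))
               (trans (ΣΣ-* (λ a → f a + f a) g) (cong (_* Σ n g) (Σℚ.∑-distrib-+ m f f))) ⟩
    toℚ n * sumOfSquares m f + (Σ m f + Σ m f) * Σ n g + toℚ m * sumOfSquares n g
      ∎
    where
    open ≡-Reasoning
    square-+ : ∀ x y → (x + y) * (x + y) ≡ x * x + (x + x) * y + y * y
    square-+ = solve-∀ ℚ-ring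

  dispersion-combine-+ : dispersion (m ℕ.* n) h
                           ≡ toℚ n * toℚ n * dispersion m f + toℚ m * toℚ m * dispersion n g
  dispersion-combine-+ = begin
    toℚ (m ℕ.* n) * sumOfSquares (m ℕ.* n) h - Σ (m ℕ.* n) h * Σ (m ℕ.* n) h
      ≡⟨ cong₂ (λ x y → x - y * y) (cong₂ _*_ (toℚ-* m n) sumOfSquares-combine-+) Σ-combine-+ ⟩
    (M * N) * (N * t₁ + (s₁ + s₁) * s₂ + M * t₂) - (N * s₁ + M * s₂) * (N * s₁ + M * s₂)
      ≡⟨ identity M N s₁ t₁ s₂ t₂ ⟩
    N * N * (M * t₁ - s₁ * s₁) + M * M * (N * t₂ - s₂ * s₂)
      ∎
    where
    open ≡-Reasoning
    M N s₁ t₁ s₂ t₂ : ℚ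
    M = toℚ m
    N = toℚ n
    s₁ = Σ m f
    t₁ = sumOfSquares m f
    s₂ = Σ n g
    t₂ = sumOfSquares n g
    identity : ∀ M N s₁ t₁ s₂ t₂ →
      (M * N) * (N * t₁ + (s₁ + s₁) * s₂ + M * t₂) - (N * s₁ + M * s₂) * (N * s₁ + M * s₂)
        ≡ N * N * (M * t₁ - s₁ * s₁) + M * M * (N * t₂ - s₂ * s₂)
    identity = solve-∀ ℚ-ring

Σ-square-deviation : ∀ N (f : Fin N → ℚ) x →
  Σ N (λ i → (f i - x) * (f i - x)) ≡ sumOfSquares N f + (- (x + x)) * Σ N f + toℚ N * (x * x)
Σ-square-deviation N f x = begin
  Σ N (λ i → (f i - x) * (f i - x))
    ≡⟨ Σℚ.∑-cong N (λ i → square-- (f i) x) ⟩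
  Σ N (λ i → f i * f i + (- (x + x)) * f i + x * x)
    ≡⟨ Σℚ.∑-distrib-+ N _ _ ⟩
  Σ N (λ i → f i * f i + (- (x + x)) * f i) + Σ N (λ _ → x * x)
    ≡⟨ cong₂ _+_ (trans (Σℚ.∑-distrib-+ N _ _)
                        (cong (λ s → sumOfSquares N f + s) (sym (Σℚ.*-distribˡ-∑ N (- (x + x)) f))))
                 (Σ-const N (x * x)) ⟩
  sumOfSquares N f + (- (x + x)) * Σ N f + toℚ N * (x * x)
    ∎
  where
  open ≡-Reasoning
  square-- : ∀ y x → (y - x) * (y - x) ≡ y * y + (- (x + x)) * y + x * x
  square-- = solve-∀ ℚ-ring

Σ≡mean*N : ∀ N .{{_ : NonZero N}} (f : Fin N → ℚ) → Σ N f ≡ mean N f * toℚ N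
Σ≡mean*N N f = begin
  Σ N f                            ≡⟨ ℚP.*-identityʳ (Σ N f) ⟨
  Σ N f * 1ℚ                       ≡⟨ cong (Σ N f *_) (trans (ℚP.*-comm _ (toℚ N)) (toℚ-*-inverse N)) ⟨
  Σ N f * ((+ 1) / N * toℚ N)      ≡⟨ ℚP.*-assoc (Σ N f) _ (toℚ N) ⟨
  mean N f * toℚ N                 ∎
  where open ≡-Reasoning

variance-dispersion : ∀ N .{{_ : NonZero N}} (f : Fin N → ℚ) →
  variance N f * (toℚ N * toℚ N) ≡ dispersion N f
variance-dispersion N f = begin
  Σ N (λ i → (f i - μ) * (f i - μ)) * p * (ν * ν)
    ≡⟨ cong (λ x → x * p * (ν * ν)) (Σ-square-deviation N f μ) ⟩
  (sumOfSquares N f + (- (μ + μ)) * Σ N f + ν * (μ * μ)) * p * (ν * ν)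
    ≡⟨ cong (λ s → (sumOfSquares N f + (- (μ + μ)) * s + ν * (μ * μ)) * p * (ν * ν)) (Σ≡mean*N N f) ⟩
  (sumOfSquares N f + (- (μ + μ)) * (μ * ν) + ν * (μ * μ)) * p * (ν * ν)
    ≡⟨ identity (sumOfSquares N f) μ ν p ⟩
  (ν * sumOfSquares N f - (μ * ν) * (μ * ν)) * (ν * p)
    ≡⟨ cong₂ (λ s x → (ν * sumOfSquares N f - s * s) * x) (Σ≡mean*N N f) (sym (toℚ-*-inverse N)) ⟨
  dispersion N f * 1ℚ
    ≡⟨ ℚP.*-identityʳ _ ⟩
  dispersion N f
    ∎
  where
  open ≡-Reasoning
  μ ν p : ℚ
  μ = mean N f
  ν = toℚ N
  p = (+ 1) / N
  identity : ∀ t μ ν p →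
    (t + (- (μ + μ)) * (μ * ν) + ν * (μ * μ)) * p * (ν * ν) ≡ (ν * t - (μ * ν) * (μ * ν)) * (ν * p)
  identity = solve-∀ ℚ-ring

data CvView {N} (f : Fin N → ℚ) : Maybe ℚ → Set where
  undefined : Σ N f ≡ 0ℚ → CvView f nothing
  defined   : ∀ {c} → Σ N f ≢ 0ℚ → c * (Σ N f * Σ N f) ≡ dispersion N f → CvView f (just c)

cv-view : ∀ {N} (f : Fin N → ℚ) → CvView f (cv N f)
cv-view {zero}  f = undefined refl
cv-view {suc N} f with mean (suc N) f ℚ.≟ 0ℚ
... | yes μ≡0 =
  undefined (trans (Σ≡mean*N (suc N) f) (trans (cong (_* toℚ (suc N)) μ≡0) (ℚP.*-zeroˡ (toℚ (suc N)))))
... | no  μ≢0 = defined Σ≢0 (begin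
  variance (suc N) f * (1/ μ * 1/ μ) * (Σ (suc N) f * Σ (suc N) f)
    ≡⟨ cong (λ s → variance (suc N) f * (1/ μ * 1/ μ) * (s * s)) (Σ≡mean*N (suc N) f) ⟩
  variance (suc N) f * (1/ μ * 1/ μ) * ((μ * ν) * (μ * ν))
    ≡⟨ identity (variance (suc N) f) (1/ μ) μ ν ⟩
  variance (suc N) f * (ν * ν) * ((μ * 1/ μ) * (μ * 1/ μ))
    ≡⟨ cong₂ (λ x y → x * (y * y)) (variance-dispersion (suc N) f) (ℚP.*-inverseʳ μ) ⟩
  dispersion (suc N) f * (1ℚ * 1ℚ)
    ≡⟨ ℚP.*-identityʳ _ ⟩
  dispersion (suc N) f
    ∎)
  where
  open ≡-Reasoning
  μ ν : ℚ
  μ = mean (suc N) f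
  ν = toℚ (suc N)
  instance
    μ-nonZero : ℚ.NonZero μ
    μ-nonZero = ℚ.≢-nonZero μ≢0
  identity : ∀ v r μ ν → v * (r * r) * ((μ * ν) * (μ * ν)) ≡ v * (ν * ν) * ((μ * r) * (μ * r))
  identity = solve-∀ ℚ-ring
  Σ≢0 : Σ (suc N) f ≢ 0ℚ
  Σ≢0 Σ≡0 = μ≢0 (trans (cong (_* ((+ 1) / suc N)) Σ≡0) (ℚP.*-zeroˡ ((+ 1) / suc N)))

cv-scale : ∀ {N₁ N₂} k .{{_ : NonZero k}} .{{_ : NonZero N₁}} .{{_ : NonZero N₂}}
           (f₁ : Fin N₁ → ℚ) (f₂ : Fin N₂ → ℚ) →
           toℚ N₁ * Σ N₂ f₂ ≡ toℚ k * toℚ N₂ * Σ N₁ f₁ →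
           toℚ N₁ * toℚ N₁ * dispersion N₂ f₂ ≡ toℚ k * toℚ N₂ * toℚ N₂ * dispersion N₁ f₁ →
           cv N₂ f₂ ≡ map (λ c → c * ((+ 1) / k)) (cv N₁ f₁)
cv-scale {N₁} {N₂} k f₁ f₂ Σ-scale D-scale with cv N₁ f₁ | cv-view f₁ | cv N₂ f₂ | cv-view f₂
... | nothing | undefined _     | nothing | undefined _ = refl
... | nothing | undefined Σ₁≡0  | just _  | defined Σ₂≢0 _ =
  ⊥-elim (Σ₂≢0 (p≢0∧p*q≡0⇒q≡0 (toℚ-≢0 N₁)
                 (trans Σ-scale (trans (cong (toℚ k * toℚ N₂ *_) Σ₁≡0) (ℚP.*-zeroʳ (toℚ k * toℚ N₂))))))
... | just _  | defined Σ₁≢0 _ | nothing | undefined Σ₂≡0 =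
  ⊥-elim (Σ₁≢0 (p≢0∧p*q≡0⇒q≡0 (*-≢0 (toℚ-≢0 k) (toℚ-≢0 N₂))
                 (trans (sym Σ-scale) (trans (cong (toℚ N₁ *_) Σ₂≡0) (ℚP.*-zeroʳ (toℚ N₁))))))
... | just c₁ | defined _ c₁-spec | just c₂ | defined Σ₂≢0 c₂-spec =
  cong just (sym (*-cancelʳ-≢0 (N₁Σ₂ * N₁Σ₂) (*-≢0 N₁Σ₂≢0 N₁Σ₂≢0) (begin
    c₁ * ((+ 1) / k) * (N₁Σ₂ * N₁Σ₂)
      ≡⟨ cong (λ x → c₁ * ((+ 1) / k) * (x * x)) Σ-scale ⟩
    c₁ * ((+ 1) / k) * ((κ * ν₂ * Σ₁) * (κ * ν₂ * Σ₁))
      ≡⟨ identity₁ c₁ ((+ 1) / k) κ ν₂ Σ₁ ⟩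
    (κ * ((+ 1) / k)) * (κ * ν₂ * ν₂ * (c₁ * (Σ₁ * Σ₁)))
      ≡⟨ cong₂ (λ x y → x * (κ * ν₂ * ν₂ * y)) (toℚ-*-inverse k) c₁-spec ⟩
    1ℚ * (κ * ν₂ * ν₂ * dispersion N₁ f₁)
      ≡⟨ trans (ℚP.*-identityˡ _) (sym D-scale) ⟩
    ν₁ * ν₁ * dispersion N₂ f₂
      ≡⟨ cong (ν₁ * ν₁ *_) c₂-spec ⟨
    ν₁ * ν₁ * (c₂ * (Σ₂ * Σ₂))
      ≡⟨ identity₂ c₂ ν₁ Σ₂ ⟩
    c₂ * (N₁Σ₂ * N₁Σ₂)
      ∎)))
  where
  open ≡-Reasoning
  κ ν₁ ν₂ Σ₁ Σ₂ N₁Σ₂ : ℚ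
  κ = toℚ k
  ν₁ = toℚ N₁
  ν₂ = toℚ N₂
  Σ₁ = Σ N₁ f₁
  Σ₂ = Σ N₂ f₂
  N₁Σ₂ = ν₁ * Σ₂
  N₁Σ₂≢0 : N₁Σ₂ ≢ 0ℚ
  N₁Σ₂≢0 = *-≢0 (toℚ-≢0 N₁) Σ₂≢0
  identity₁ : ∀ c r κ ν s → c * r * ((κ * ν * s) * (κ * ν * s)) ≡ (κ * r) * (κ * ν * ν * (c * (s * s)))
  identity₁ = solve-∀ ℚ-ring
  identity₂ : ∀ c ν s → ν * ν * (c * (s * s)) ≡ c * ((ν * s) * (ν * s))
  identity₂ = solve-∀ ℚ-ring

degreeℚ : (G : Graph) → Fin (n G) → ℚ
degreeℚ G u = toℚ (degree G u)

^□-nonZero : ∀ G k .{{_ : NonZero (n G)}} → NonZero (n (G ^□ k))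
^□-nonZero G zero    = ℕ.nonZero
^□-nonZero G (suc k) {{G≢0}} = ℕP.m*n≢0 (n G) (n (G ^□ k)) {{G≢0}} {{^□-nonZero G k}}

module _ (G : Graph) (loopless : ∀ u → adj G u u ≡ false) where

  private
    ν : ℕ → ℚ
    ν k = toℚ (n (G ^□ k))

    ν-suc : ∀ k → ν (suc k) ≡ toℚ (n G) * ν k
    ν-suc k = toℚ-* (n G) (n (G ^□ k))

    degreeℚ-^□-suc : ∀ k a b → degreeℚ (G ^□ suc k) (combine a b) ≡ degreeℚ G a + degreeℚ (G ^□ k) b
    degreeℚ-^□-suc k a b =
      trans (cong toℚ (degree-□ G (G ^□ k) loopless a b)) (toℚ-+ (degree G a) (degree (G ^□ k) b))

  Σ-degree-^□ : ∀ k → toℚ (n G) * Σ (n (G ^□ k)) (degreeℚ (G ^□ k))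
                        ≡ toℚ k * ν k * Σ (n G) (degreeℚ G)
  Σ-degree-^□ zero    = identity (toℚ (n G)) (ν 0) (Σ (n G) (degreeℚ G))
    where
    identity : ∀ ν₁ ν₀ s → ν₁ * 0ℚ ≡ 0ℚ * ν₀ * s
    identity = solve-∀ ℚ-ring
  Σ-degree-^□ (suc k) = begin
    ν₁ * Σ (n (G ^□ suc k)) (degreeℚ (G ^□ suc k))
      ≡⟨ cong (ν₁ *_) (Σ-combine-+ (degreeℚ G) (degreeℚ (G ^□ k)) _ (degreeℚ-^□-suc k)) ⟩
    ν₁ * (ν k * s + ν₁ * Σ (n (G ^□ k)) (degreeℚ (G ^□ k)))
      ≡⟨ cong (λ x → ν₁ * (ν k * s + x)) (Σ-degree-^□ k) ⟩
    ν₁ * (ν k * s + toℚ k * ν k * s)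
      ≡⟨ identity ν₁ (ν k) s (toℚ k) ⟩
    (1ℚ + toℚ k) * (ν₁ * ν k) * s
      ≡⟨ cong₂ (λ x y → x * y * s) (toℚ-+ 1 k) (ν-suc k) ⟨
    toℚ (suc k) * ν (suc k) * s
      ∎
    where
    open ≡-Reasoning
    ν₁ s : ℚ
    ν₁ = toℚ (n G)
    s = Σ (n G) (degreeℚ G)
    identity : ∀ ν₁ νₖ s κ → ν₁ * (νₖ * s + κ * νₖ * s) ≡ (1ℚ + κ) * (ν₁ * νₖ) * s
    identity = solve-∀ ℚ-ring

  dispersion-degree-^□ : ∀ k → toℚ (n G) * toℚ (n G) * dispersion (n (G ^□ k)) (degreeℚ (G ^□ k))
                                 ≡ toℚ k * ν k * ν k * dispersion (n G) (degreeℚ G)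
  dispersion-degree-^□ zero    = identity (toℚ (n G)) (ν 0) (dispersion (n G) (degreeℚ G))
    where
    identity : ∀ ν₁ ν₀ d → ν₁ * ν₁ * 0ℚ ≡ 0ℚ * ν₀ * ν₀ * d
    identity = solve-∀ ℚ-ring
  dispersion-degree-^□ (suc k) = begin
    ν₁ * ν₁ * dispersion (n (G ^□ suc k)) (degreeℚ (G ^□ suc k))
      ≡⟨ cong (ν₁ * ν₁ *_) (dispersion-combine-+ (degreeℚ G) (degreeℚ (G ^□ k)) _ (degreeℚ-^□-suc k)) ⟩
    ν₁ * ν₁ * (ν k * ν k * d + ν₁ * ν₁ * dispersion (n (G ^□ k)) (degreeℚ (G ^□ k)))
      ≡⟨ cong (λ x → ν₁ * ν₁ * (ν k * ν k * d + x)) (dispersion-degree-^□ k) ⟩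
    ν₁ * ν₁ * (ν k * ν k * d + toℚ k * ν k * ν k * d)
      ≡⟨ identity ν₁ (ν k) d (toℚ k) ⟩
    (1ℚ + toℚ k) * (ν₁ * ν k) * (ν₁ * ν k) * d
      ≡⟨ cong₂ (λ x y → x * y * y * d) (toℚ-+ 1 k) (ν-suc k) ⟨
    toℚ (suc k) * ν (suc k) * ν (suc k) * d
      ∎
    where
    open ≡-Reasoning
    ν₁ d : ℚ
    ν₁ = toℚ (n G)
    d = dispersion (n G) (degreeℚ G)
    identity : ∀ ν₁ νₖ d κ →
      ν₁ * ν₁ * (νₖ * νₖ * d + κ * νₖ * νₖ * d) ≡ (1ℚ + κ) * (ν₁ * νₖ) * (ν₁ * νₖ) * d
    identity = solve-∀ ℚ-ring

mainTheorem17 : (G : Graph) → IsSimple G → Connected G →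
    (k : ℕ) → .{{_ : NonZero k}} →
    cd (G ^□ k) ≡ map (λ c → c * ((+ 1) / k)) (cd G)
-- Connectedness is used only for nonemptiness: the identity holds for every loopless graph
-- with at least one vertex.
mainTheorem17 G simple connected k =
  cv-scale k (degreeℚ G) (degreeℚ (G ^□ k)) (Σ-degree-^□ G loopless k) (dispersion-degree-^□ G loopless k)
  where
  loopless : ∀ u → adj G u u ≡ false
  loopless = IsSimple.irreflexive simple
  instance
    G-nonZero : NonZero (n G)
    G-nonZero = ℕ.>-nonZero (Connected.nonempty connected)
    G^k-nonZero : NonZero (n (G ^□ k))
    G^k-nonZero = ^□-nonZero G k
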